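{- Let $n>3$ be an odd integer and let $$f_{n,1}(x)=\sum_{j\geq 0}\binom{n-1}{2j+1}(x^j-x^{j+1})+2\sum_{j\geq 0}\binom{n}{2j}x^j\in\mathbb{Z}[x],\qquad C_n(x):=f_{n,1}(x)-(n+1)x^{(n-1)/2}.$$ Then, with $N=(n-1)/2$, $C_n(x)$ viewed as an element of $\mathbb{Z}[x]/(x^N-1)$ is a coterm polynomial.
   Context: For a commutative ring $R$ with identity and $N\ge1$, a polynomial $a_0+a_1x+\cdots+a_{N-1}x^{N-1}\in R[x]/(x^N-1)$ with $a_i\in R$ is a coterm polynomial if $a_i=a_{N-i}$ for all $1\le i\le\lfloor N/2\rfloor$. Binomial coefficients $\binom{a}{b}$ are $0$ when $b>a$. -}

module Defs where

open import Data.Nat using (ℕ; zero; suc; _+_; _*_; _∸_; _≡ᵇ_; _%_; _/_)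
open import Data.Nat.Combinatorics using (_C_)
open import Data.Integer using (ℤ; +_; _-_) renaming (_+_ to _+ℤ_; _*_ to _*ℤ_)
open import Data.Bool using (if_then_else_)
open import Data.List using (upTo; map; foldr)
open import Relation.Binary.PropositionalEquality using (_≡_)

-- Polynomials in ℤ[x] are represented by coefficient functions ℕ → ℤ
-- (coefficient of x^k), together with a degree bound where needed.

sumTo : ℕ → (ℕ → ℤ) → ℤ
sumTo m f = foldr _+ℤ_ (+ 0) (map f (upTo m))

-- coefficient of x^k in  Σ_{j≥0} C(n-1,2j+1) (x^j - x^{j+1})
--   = C(n-1,2k+1) - C(n-1,2k-1)   (second term absent when k = 0)
sumA : ℕ → ℕ → ℤ
sumA n zero    = + ((n ∸ 1) C 1)
sumA n (suc k) = + ((n ∸ 1) C (2 * suc k + 1)) - + ((n ∸ 1) C (2 * k + 1))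

-- coefficient of x^k in  2 Σ_{j≥0} C(n,2j) x^j
sumB : ℕ → ℕ → ℤ
sumB n k = + (2 * (n C (2 * k)))

fn1 : ℕ → ℕ → ℤ
fn1 n k = sumA n k +ℤ sumB n k

Cn : ℕ → ℕ → ℤ
Cn n k = fn1 n k - (if k ≡ᵇ ((n ∸ 1) / 2) then + (n + 1) else + 0)

-- Image in ℤ[x]/(x^N - 1) of a polynomial p with deg p < D:
-- coefficient a_i (0 ≤ i < N) = Σ_{k < D, k ≡ i mod N} p_k.
reduceMod : (N D : ℕ) → .{{_ : Data.Nat.NonZero N}} → (ℕ → ℤ) → ℕ → ℤ
reduceMod N D p i = sumTo D (λ k → if (k % N) ≡ᵇ i then p k else + 0)

IsCoterm : (N : ℕ) → (ℕ → ℤ) → Set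
IsCoterm N a = (i : ℕ) → 1 Data.Nat.≤ i → i Data.Nat.≤ N / 2 → a i ≡ a (N ∸ i)

-- By Pascal's rule the two sums defining f_{n,1} telescope: its coefficient of x^k
-- is C(n-1,2k-1) + 2 C(n-1,2k) + C(n-1,2k+1) = C(n+1,2k+1).  For n = 2N + 1 the
-- correction term only touches x^N, so C_n has degree at most N, and modulo x^N - 1
-- its coefficients for 1 ≤ k < N are still C(n+1,2k+1).  These are symmetric under
-- k ↦ N - k because (2k+1) + (2(N-k)+1) = n + 1.
module Submission where

open import Defs
open import Data.Nat using (ℕ; suc; _+_; _*_; _∸_; _/_; _<_; NonZero)
open import Relation.Binary.PropositionalEquality using (_≡_)

open import Data.Nat using (zero; _≤_; _≡ᵇ_; _%_; _≟_; z≤n; s≤s)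
open import Data.Nat.Properties
open import Data.Nat.DivMod using (m<n⇒m%n≡m; n%n≡0; m*n/n≡m; m/n<m)
open import Data.Nat.Combinatorics using (_C_; nC1≡n; nCk≡nC[n∸k]; nCk+nC[k+1]≡[n+1]C[k+1]; k>n⇒nCk≡0)
open import Data.Nat.Tactic.RingSolver using (solve-∀)
open import Data.Integer using (ℤ; +_; _-_) renaming (_+_ to _+ℤ_)
import Data.Integer.Properties as ℤ
open import Data.Integer.Solver using (module +-*-Solver)
open import Data.Bool using (false; if_then_else_)
open import Data.Bool.Properties using (if-eta)
open import Data.List using (upTo; map; foldr)
open import Data.List.Properties using (map-cong; map-applyUpTo; map-upTo)
open import Relation.Binary.PropositionalEquality using (_≢_; refl; sym; trans; cong; cong₂; subst; module ≡-Reasoning)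
open import Relation.Binary.Definitions using (tri<; tri≈; tri>)
open import Relation.Nullary.Decidable using (dec-false)
open import Function using (_∘_)

open ≡-Reasoning

sumTo-suc : ∀ D (f : ℕ → ℤ) → sumTo (suc D) f ≡ f 0 +ℤ sumTo D (f ∘ suc)
sumTo-suc D f = cong (λ xs → f 0 +ℤ foldr _+ℤ_ (+ 0) xs)
  (trans (map-applyUpTo suc f D) (sym (map-upTo (f ∘ suc) D)))

sumTo-cong : ∀ D {f g : ℕ → ℤ} → (∀ k → f k ≡ g k) → sumTo D f ≡ sumTo D g
sumTo-cong D f≗g = cong (foldr _+ℤ_ (+ 0)) (map-cong f≗g (upTo D))

sumTo-zero : ∀ D → sumTo D (λ _ → + 0) ≡ + 0
sumTo-zero zero    = refl
sumTo-zero (suc D) = trans (sumTo-suc D (λ _ → + 0)) (trans (ℤ.+-identityˡ _) (sumTo-zero D))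

sumTo-single : ∀ D i (c : ℕ → ℤ) → i < D →
  sumTo D (λ k → if k ≡ᵇ i then c k else + 0) ≡ c i
sumTo-single (suc D) zero c _ = begin
  sumTo (suc D) (λ k → if k ≡ᵇ 0 then c k else + 0) ≡⟨ sumTo-suc D (λ k → if k ≡ᵇ 0 then c k else + 0) ⟩
  c 0 +ℤ sumTo D (λ _ → + 0)                         ≡⟨ cong (c 0 +ℤ_) (sumTo-zero D) ⟩
  c 0 +ℤ + 0                                         ≡⟨ ℤ.+-identityʳ (c 0) ⟩
  c 0                                                ∎
sumTo-single (suc D) (suc i) c (s≤s i<D) =
  trans (sumTo-suc D (λ k → if k ≡ᵇ suc i then c k else + 0))
        (trans (ℤ.+-identityˡ _) (sumTo-single D i (c ∘ suc) i<D))

≢⇒≡ᵇ-false : ∀ {m n} → m ≢ n → (m ≡ᵇ n) ≡ false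
≢⇒≡ᵇ-false {m} {n} = dec-false (m ≟ n)

-- Only k = i contributes to residue i: k = N lands on residue 0 ≠ i, and p vanishes beyond N.
reduceMod≡coefficient : ∀ N D (p : ℕ → ℤ) .{{_ : NonZero N}} → (∀ k → N < k → p k ≡ + 0) →
  ∀ i → 1 ≤ i → i < N → N ≤ D → reduceMod N D p i ≡ p i
reduceMod≡coefficient N D p {{N≢0}} vanish i 1≤i i<N N≤D =
  trans (sumTo-cong D residue≡index) (sumTo-single D i p (<-≤-trans i<N N≤D))
  where
  residue≡index : ∀ k → (if k % N ≡ᵇ i then p k else + 0) ≡ (if k ≡ᵇ i then p k else + 0)
  residue≡index k with <-cmp k N
  ... | tri< k<N _ _ rewrite m<n⇒m%n≡m k<N = refl
  ... | tri≈ _ refl _ rewrite n%n≡0 k {{N≢0}}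
                            | ≢⇒≡ᵇ-false {0} {i} (λ 0≡i → <-irrefl 0≡i 1≤i)
                            | ≢⇒≡ᵇ-false {k} {i} (λ k≡i → <-irrefl (sym k≡i) i<N) = refl
  ... | tri> _ _ N<k rewrite vanish k N<k = trans (if-eta (k % N ≡ᵇ i)) (sym (if-eta (k ≡ᵇ i)))

pascal₂ : ∀ n k → n C k + 2 * (n C suc k) + n C suc (suc k) ≡ suc (suc n) C suc (suc k)
pascal₂ n k = begin
  n C k + 2 * (n C suc k) + n C suc (suc k)
    ≡⟨ regroup (n C k) (n C suc k) (n C suc (suc k)) ⟩
  (n C k + n C suc k) + (n C suc k + n C suc (suc k))
    ≡⟨ cong₂ _+_ (nCk+nC[k+1]≡[n+1]C[k+1] n k) (nCk+nC[k+1]≡[n+1]C[k+1] n (suc k)) ⟩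
  suc n C suc k + suc n C suc (suc k)
    ≡⟨ nCk+nC[k+1]≡[n+1]C[k+1] (suc n) (suc k) ⟩
  suc (suc n) C suc (suc k) ∎
  where
  regroup : ∀ x y z → x + 2 * y + z ≡ (x + y) + (y + z)
  regroup = solve-∀

telescope : ∀ x y z → + z - + x +ℤ + (2 * (x + y)) ≡ + (x + 2 * y + z)
telescope x y z = begin
  + z - + x +ℤ + (2 * (x + y))     ≡⟨ cong (λ t → + z - + x +ℤ + t) (double-sum x y) ⟩
  + z - + x +ℤ + (x + (x + 2 * y)) ≡⟨ cong (+ z - + x +ℤ_) (ℤ.pos-+ x (x + 2 * y)) ⟩
  + z - + x +ℤ (+ x +ℤ + w)        ≡⟨ cancel (+ x) (+ w) (+ z) ⟩
  + w +ℤ + z                       ≡⟨ ℤ.pos-+ w z ⟨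
  + (w + z)                        ∎
  where
  w = x + 2 * y
  double-sum : ∀ x y → 2 * (x + y) ≡ x + (x + 2 * y)
  double-sum = solve-∀
  cancel : ∀ a b c → c - a +ℤ (a +ℤ b) ≡ b +ℤ c
  cancel = solve 3 (λ a b c → (c :- a) :+ (a :+ b) := b :+ c) refl
    where open +-*-Solver

fn1≡binomial : ∀ n k → fn1 (suc n) k ≡ + (suc (suc n) C suc (2 * k))
fn1≡binomial n zero = begin
  + (n C 1) +ℤ + 2           ≡⟨ cong (λ t → + t +ℤ + 2) (nC1≡n n) ⟩
  + (n + 2)                  ≡⟨ cong +_ (+-comm n 2) ⟩
  + suc (suc n)              ≡⟨ cong +_ (nC1≡n (suc (suc n))) ⟨
  + (suc (suc n) C 1)        ∎
fn1≡binomial n (suc a) = begin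
  + (n C (2 * suc a + 1)) - + (n C k) +ℤ + (2 * (suc n C (2 * suc a)))
    ≡⟨ cong₂ (λ s t → + (n C s) - + (n C k) +ℤ + (2 * (suc n C t))) (2[1+a]+1 a) (2[1+a] a) ⟩
  + (n C suc (suc k)) - + (n C k) +ℤ + (2 * (suc n C suc k))
    ≡⟨ cong (λ t → + (n C suc (suc k)) - + (n C k) +ℤ + (2 * t)) (nCk+nC[k+1]≡[n+1]C[k+1] n k) ⟨
  + (n C suc (suc k)) - + (n C k) +ℤ + (2 * (n C k + n C suc k))
    ≡⟨ telescope (n C k) (n C suc k) (n C suc (suc k)) ⟩
  + (n C k + 2 * (n C suc k) + n C suc (suc k))
    ≡⟨ cong +_ (pascal₂ n k) ⟩
  + (suc (suc n) C suc (suc k))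
    ≡⟨ cong (λ t → + (suc (suc n) C suc t)) (2[1+a] a) ⟨
  + (suc (suc n) C suc (2 * suc a)) ∎
  where
  k = 2 * a + 1
  2[1+a] : ∀ a → 2 * suc a ≡ suc (2 * a + 1)
  2[1+a] = solve-∀
  2[1+a]+1 : ∀ a → 2 * suc a + 1 ≡ suc (suc (2 * a + 1))
  2[1+a]+1 = solve-∀

double/2 : ∀ m → 2 * m / 2 ≡ m
double/2 m = trans (cong (_/ 2) (*-comm 2 m)) (m*n/n≡m m 2)

Cn-odd : ∀ m k → k ≢ m → Cn (suc (2 * m)) k ≡ + (suc (suc (2 * m)) C suc (2 * k))
Cn-odd m k k≢m = begin
  fn1 (suc (2 * m)) k - (if k ≡ᵇ 2 * m / 2 then + (suc (2 * m) + 1) else + 0)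
    ≡⟨ cong (λ b → fn1 (suc (2 * m)) k - (if b then + (suc (2 * m) + 1) else + 0)) k≡ᵇm ⟩
  fn1 (suc (2 * m)) k - + 0
    ≡⟨ ℤ.+-identityʳ _ ⟩
  fn1 (suc (2 * m)) k
    ≡⟨ fn1≡binomial (2 * m) k ⟩
  + (suc (suc (2 * m)) C suc (2 * k)) ∎
  where
  k≡ᵇm : (k ≡ᵇ 2 * m / 2) ≡ false
  k≡ᵇm = ≢⇒≡ᵇ-false (λ k≡2m/2 → k≢m (trans k≡2m/2 (double/2 m)))

Cn-odd-vanish : ∀ m k → m < k → Cn (suc (2 * m)) k ≡ + 0
Cn-odd-vanish m k m<k = trans (Cn-odd m k (λ k≡m → <-irrefl (sym k≡m) m<k))
  (cong +_ (k>n⇒nCk≡0 (s≤s (subst (_≤ 2 * k) (*-suc 2 m) (*-monoʳ-≤ 2 m<k)))))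

C-sym : ∀ p q → (p + q) C p ≡ (p + q) C q
C-sym p q = trans (nCk≡nC[n∸k] (m≤m+n p q)) (cong ((p + q) C_) (m+n∸m≡n p q))

Cn-odd-sym : ∀ m i j → i + j ≡ m → 1 ≤ i → 1 ≤ j → Cn (suc (2 * m)) i ≡ Cn (suc (2 * m)) j
Cn-odd-sym .(i + j) i j refl 1≤i 1≤j = begin
  Cn (suc (2 * (i + j))) i                       ≡⟨ Cn-odd (i + j) i (λ i≡i+j → <-irrefl i≡i+j (m<m+n i 1≤j)) ⟩
  + (suc (suc (2 * (i + j))) C suc (2 * i))      ≡⟨ cong (λ t → + (t C suc (2 * i))) (odd+odd i j) ⟩
  + ((suc (2 * i) + suc (2 * j)) C suc (2 * i))  ≡⟨ cong +_ (C-sym (suc (2 * i)) (suc (2 * j))) ⟩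
  + ((suc (2 * i) + suc (2 * j)) C suc (2 * j))  ≡⟨ cong (λ t → + (t C suc (2 * j))) (odd+odd i j) ⟨
  + (suc (suc (2 * (i + j))) C suc (2 * j))      ≡⟨ Cn-odd (i + j) j (λ j≡i+j → <-irrefl j≡i+j (m<n+m j 1≤i)) ⟨
  Cn (suc (2 * (i + j))) j                       ∎
  where
  odd+odd : ∀ i j → suc (suc (2 * (i + j))) ≡ suc (2 * i) + suc (2 * j)
  odd+odd = solve-∀

Cn-odd-coterm : ∀ m .{{_ : NonZero m}} → IsCoterm m (reduceMod m (suc (2 * m) + 1) (Cn (suc (2 * m))))
Cn-odd-coterm m i 1≤i i≤m/2 = begin
  reduceMod m D p i        ≡⟨ reduceMod≡coefficient m D p (Cn-odd-vanish m) i 1≤i i<m m≤D ⟩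
  p i                      ≡⟨ Cn-odd-sym m i (m ∸ i) (m+[n∸m]≡n (<⇒≤ i<m)) 1≤i (m<n⇒0<n∸m i<m) ⟩
  p (m ∸ i)                ≡⟨ reduceMod≡coefficient m D p (Cn-odd-vanish m) (m ∸ i) (m<n⇒0<n∸m i<m) m∸i<m m≤D ⟨
  reduceMod m D p (m ∸ i)  ∎
  where
  D = suc (2 * m) + 1
  p = Cn (suc (2 * m))
  i<m : i < m
  i<m = ≤-<-trans i≤m/2 (m/n<m m 2 (s≤s (s≤s z≤n)))
  m∸i<m : m ∸ i < m
  m∸i<m = ∸-monoʳ-< 1≤i (<⇒≤ i<m)
  m≤D : m ≤ D
  m≤D = ≤-trans (m≤m+n m (m + 0)) (≤-trans (n≤1+n (2 * m)) (m≤m+n (suc (2 * m)) 1))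

theorem5p5 : (n m : ℕ) → n ≡ 2 * m + 1 → 3 < n →
    (nz : NonZero ((n ∸ 1) / 2)) →
    IsCoterm ((n ∸ 1) / 2) (reduceMod ((n ∸ 1) / 2) (n + 1) {{nz}} (Cn n))
theorem5p5 n m n≡2m+1 _ rewrite trans n≡2m+1 (+-comm (2 * m) 1) =
  subst (λ N → (nz : NonZero N) → IsCoterm N (reduceMod N (suc (2 * m) + 1) {{nz}} (Cn (suc (2 * m)))))
    (sym (double/2 m)) (λ nz → Cn-odd-coterm m {{nz}})
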